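{- Let $a,b,y$ be parameters (complex numbers with $y\neq 1$, or indeterminates), and let $$E(t,y;a,b)=\frac{(1-y)\,e^{a t(1-y)}}{1-y\,e^{bt(1-y)}},$$ regarded as a formal power series in $t$ with constant term $1$. Let $G(x,y;a,b)=\mathcal{T}(E(t,y;a,b))(x)$. Then $$G(x,y;a,b)=\mathcal{J}\bigl(y(b-a)+a,\; b(y+1),\; b(y+1),\; b(y+1),\ldots;\; b^2y,\; b^2y,\; b^2y,\ldots\bigr).$$
   Context: Formal Sumudu transform: for a power series $f(t)=\sum_{n\ge0} f_n \frac{t^n}{n!}$, its Sumudu transform $\mathcal{S}(f)(x)=\frac1x\int_0^\infty f(t)e^{ -t/x}\,dt$ is, formally, $\sum_{n\ge0} f_n x^n$. For a power series $F(x)=x+\cdots$, $\mathrm{Rev}(F)$ denotes its compositional inverse. The transformation $\mathcal{T}$ applied to a power series $E(t)$ with $E(0)=1$ is defined by: form $1/E(t)$; take its Sumudu transform $g(x)=\mathcal{S}(1/E)(x)$; then set $\mathcal{T}(E)(x)=\frac{1}{x}\mathrm{Rev}(x\,g(x))$. Notation $\mathcal{J}$: for sequences $(c_0,c_1,c_2,\ldots)$ and $(d_1,d_2,\ldots)$, $\mathcal{J}(c_0,c_1,c_2,\ldots;d_1,d_2,\ldots)$ denotes the formal power series given by the Jacobi continued fraction $$\cfrac{1}{1-c_0x-\cfrac{d_1x^2}{1-c_1x-\cfrac{d_2x^2}{1-c_2x-\cdots}}}.$$ -}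

module Defs where

open import Level using (Level)
open import Algebra.Bundles using (CommutativeRing)
open import Data.Nat using (ℕ; zero; suc; _∸_)
open import Data.Nat.Combinatorics using (_C_)

module Series {c ℓ : Level} (R : CommutativeRing c ℓ) where
  open CommutativeRing R

  Series : Set c
  Series = ℕ → Carrier

  _≋_ : Series → Series → Set ℓ
  f ≋ g = ∀ n → f n ≈ g n

  sumTo : ℕ → (ℕ → Carrier) → Carrier
  sumTo zero    f = 0#
  sumTo (suc n) f = sumTo n f + f n

  fromℕ : ℕ → Carrier
  fromℕ zero    = 0#
  fromℕ (suc n) = 1# + fromℕ n

  pow : Carrier → ℕ → Carrier
  pow x zero    = 1#
  pow x (suc n) = x * pow x n

  oneS : Series
  oneS zero    = 1#
  oneS (suc _) = 0#

  xS : Series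
  xS zero          = 0#
  xS (suc zero)    = 1#
  xS (suc (suc _)) = 0#

  scale : Carrier → Series → Series
  scale k f n = k * f n

  _⊕_ : Series → Series → Series
  (f ⊕ g) n = f n + g n

  _⊖_ : Series → Series → Series
  (f ⊖ g) n = f n - g n

  -- Ordinary power series (in x): f = Σ f_n x^n

  _·_ : Series → Series → Series
  (f · g) n = sumTo (suc n) (λ k → f k * g (n ∸ k))

  powS : Series → ℕ → Series
  powS K zero    = oneS
  powS K (suc m) = K · powS K m

  -- composition F ∘ K (meaningful when K 0 ≈ 0):
  -- (F ∘ K)_n = Σ_{m=0}^{n} F_m [x^n] K^m
  compose : Series → Series → Series
  compose F K n = sumTo (suc n) (λ m → F m * powS K m n)

  IsRev : Series → Series → Set ℓ
  IsRev F K = (K 0 ≈ 0#) Data.Product.× (compose F K ≋ xS)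
    where import Data.Product

  -- Exponential series in t: f(t) = Σ f_n t^n / n!, represented by (f_n).

  -- product of exponential series (binomial convolution)
  _⊙_ : Series → Series → Series
  (f ⊙ g) n = sumTo (suc n) (λ k → fromℕ (n C k) * (f k * g (n ∸ k)))

  expS : Carrier → Series
  expS k n = pow k n

  -- Sumudu transform: Σ f_n t^n/n!  ↦  Σ f_n x^n
  sumudu : Series → Series
  sumudu f = f

  -- Jacobi continued fraction J(c_0,c_1,...; d_1,d_2,...):
  -- a family of series T k (the k-th tail) with
  --   T k = 1 / (1 - c_k x - d_{k+1} x^2 T (k+1)),
  -- and the continued fraction is T 0.  (This family is unique.)
  IsJacobiTails : (ℕ → Carrier) → (ℕ → Carrier) → (ℕ → Series) → Set ℓ
  IsJacobiTails cs ds T =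
    ∀ k → (T k · ((oneS ⊖ scale (cs k) xS) ⊖ scale (ds (suc k)) ((xS · xS) · T (suc k)))) ≋ oneS

  cSeq : Carrier → Carrier → Carrier → ℕ → Carrier
  cSeq a b y zero    = y * (b - a) + a
  cSeq a b y (suc _) = b * (y + 1#)

module Submission where

-- Since 1/E = u (e^{-pt} - y e^{qt}) with u = 1/(1-y), p = a(1-y) and
-- q = (b-a)(1-y), the coefficients of g = S(1/E) satisfy g₀ = 1, g₁ = -α and
-- g_{n+2} = r g_{n+1} + s g_n, where r and s are the sum and minus the product
-- of the ratios -p and q.  For any such g, write Rev(x g) = x G and compose g,
-- g' = (g - 1)/x and g'' = (g' - g₁)/x with Rev(x g): the recurrence then forces
--   G = 1 + x (-r G + (r + α) G² - s x G²).
-- Any Jacobi continued fraction J(α, β, β, …; δ, δ, …) satisfies the same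
-- equation when β = r + 2α and δ = α (r + α) - s, and the equation determines
-- its solution coefficient by coefficient.

open import Defs
open import Level using (Level; 0ℓ; _⊔_)
open import Algebra.Bundles using (CommutativeRing; RawRing)
open import Data.Nat as ℕ using (ℕ; zero; suc; _∸_; _≤_; _<_; s≤s)
import Data.Nat.Properties as ℕ
open import Data.Nat.Combinatorics using (_C_; nCk+nC[k+1]≡[n+1]C[k+1]; k>n⇒nCk≡0)
open import Data.Product using (∃; _×_; _,_)
open import Data.Sum using (inj₁; inj₂)
open import Data.Maybe using (Maybe; just; nothing)
open import Relation.Nullary using (yes; no)
import Relation.Binary.PropositionalEquality as ≡
import Algebra.Solver.Ring.AlmostCommutativeRing as ACR

-- The standard library solves equations in an abstract commutative ring with
-- the ring itself as coefficients, so it never sees a coefficient vanish;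
-- this instance uses integer coefficients instead.
module IntegerCoefficientSolver {c ℓ : Level} (R : CommutativeRing c ℓ) where
  open CommutativeRing R
  open import Algebra.Properties.Ring ring
    using (-0#≈0#; -‿+-comm; ⁻¹-anti-homo‿-; +-cancelʳ; x[y-z]≈xy-xz; [y-z]x≈yx-zx)
  open import Algebra.Properties.CommutativeSemigroup +-commutativeSemigroup
    using (interchange)
  open import Algebra.Properties.Semiring.Mult.TCOptimised semiring
    using (×-homo-+; ×1-homo-*) renaming (_×_ to _×′_)
  open import Relation.Binary.Reasoning.Setoid setoid

  private
    -- The integer m - n is represented by the pair (m , n), normalised to
    -- have a zero component, since the solver compares coefficients with ≡.
    normalise : ℕ × ℕ → ℕ × ℕ
    normalise (m , n) = (m ∸ n , n ∸ m)

    ℤ-rawRing : RawRing 0ℓ 0ℓ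
    ℤ-rawRing = record
      { Carrier = ℕ × ℕ
      ; _≈_ = ≡._≡_
      ; _+_ = λ (m , n) (p , q) → normalise (m ℕ.+ p , n ℕ.+ q)
      ; _*_ = λ (m , n) (p , q) → normalise (m ℕ.* p ℕ.+ n ℕ.* q , m ℕ.* q ℕ.+ n ℕ.* p)
      ; -_ = λ (m , n) → (n , m)
      ; 0# = (0 , 0)
      ; 1# = (1 , 0)
      }

    ι : ℕ → Carrier
    ι n = n ×′ 1#

    ⟦_⟧ℤ : ℕ × ℕ → Carrier
    ⟦ m , n ⟧ℤ = ι m - ι n

    -- equal to ⟦_⟧ℤ, but evaluating the coefficients 0 and 1 to 0# and 1#
    -- on the nose, so that they appear as such in solved equations
    ⟦_⟧ᶜ : ℕ × ℕ → Carrier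
    ⟦ m , zero ⟧ᶜ = ι m
    ⟦ m , suc n ⟧ᶜ = ⟦ m , suc n ⟧ℤ

    ⟦⟧ᶜ≈⟦⟧ℤ : ∀ x → ⟦ x ⟧ᶜ ≈ ⟦ x ⟧ℤ
    ⟦⟧ᶜ≈⟦⟧ℤ (m , zero) = trans (sym (+-identityʳ (ι m))) (+-congˡ (sym -0#≈0#))
    ⟦⟧ᶜ≈⟦⟧ℤ (m , suc n) = refl

    sub-add-cancel : ∀ x y z → (x - y) + (z + y) ≈ x + z
    sub-add-cancel x y z = begin
      (x - y) + (z + y)     ≈⟨ interchange x (- y) z y ⟩
      (x + z) + (- y + y)   ≈⟨ +-congˡ (-‿inverseˡ y) ⟩
      (x + z) + 0#          ≈⟨ +-identityʳ _ ⟩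
      x + z                 ∎

    ⟦⟧ℤ-cong : ∀ m n p q → m ℕ.+ q ≡.≡ p ℕ.+ n → ⟦ m , n ⟧ℤ ≈ ⟦ p , q ⟧ℤ
    ⟦⟧ℤ-cong m n p q e = +-cancelʳ (ι q + ι n) _ _ (begin
      (ι m - ι n) + (ι q + ι n)  ≈⟨ sub-add-cancel (ι m) (ι n) (ι q) ⟩
      ι m + ι q                  ≈⟨ ×-homo-+ 1# m q ⟨
      ι (m ℕ.+ q)                ≡⟨ ≡.cong ι e ⟩
      ι (p ℕ.+ n)                ≈⟨ ×-homo-+ 1# p n ⟩
      ι p + ι n                  ≈⟨ sub-add-cancel (ι p) (ι q) (ι n) ⟨
      (ι p - ι q) + (ι n + ι q)  ≈⟨ +-congˡ (+-comm _ _) ⟩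
      (ι p - ι q) + (ι q + ι n)  ∎)

    +-∸-balance : ∀ m n → m ℕ.+ (n ∸ m) ≡.≡ (m ∸ n) ℕ.+ n
    +-∸-balance zero    zero    = ≡.refl
    +-∸-balance zero    (suc n) = ≡.refl
    +-∸-balance (suc m) zero    = ≡.refl
    +-∸-balance (suc m) (suc n) =
      ≡.trans (≡.cong suc (+-∸-balance m n)) (≡.sym (ℕ.+-suc (m ∸ n) n))

    normalise-correct : ∀ m n → ⟦ normalise (m , n) ⟧ℤ ≈ ⟦ m , n ⟧ℤ
    normalise-correct m n = ⟦⟧ℤ-cong (m ∸ n) (n ∸ m) m n (≡.sym (+-∸-balance m n))

    +-homo : ∀ m n p q → ⟦ m ℕ.+ p , n ℕ.+ q ⟧ℤ ≈ ⟦ m , n ⟧ℤ + ⟦ p , q ⟧ℤ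
    +-homo m n p q = begin
      ι (m ℕ.+ p) - ι (n ℕ.+ q)     ≈⟨ +-cong (×-homo-+ 1# m p) (-‿cong (×-homo-+ 1# n q)) ⟩
      (ι m + ι p) - (ι n + ι q)     ≈⟨ +-congˡ (-‿+-comm (ι n) (ι q)) ⟨
      (ι m + ι p) + (- ι n - ι q)   ≈⟨ interchange (ι m) (ι p) (- ι n) (- ι q) ⟩
      (ι m - ι n) + (ι p - ι q)     ∎

    *-homo : ∀ m n p q →
      ⟦ m ℕ.* p ℕ.+ n ℕ.* q , m ℕ.* q ℕ.+ n ℕ.* p ⟧ℤ ≈ ⟦ m , n ⟧ℤ * ⟦ p , q ⟧ℤ
    *-homo m n p q = begin
      ι (m ℕ.* p ℕ.+ n ℕ.* q) - ι (m ℕ.* q ℕ.+ n ℕ.* p)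
        ≈⟨ +-cong (ι-+* m p n q) (-‿cong (ι-+* m q n p)) ⟩
      (M * P + N * Q) - (M * Q + N * P)     ≈⟨ +-congˡ (-‿+-comm _ _) ⟨
      (M * P + N * Q) + (- (M * Q) - N * P) ≈⟨ interchange _ _ _ _ ⟩
      (M * P - M * Q) + (N * Q - N * P)     ≈⟨ +-congˡ (⁻¹-anti-homo‿- _ _) ⟨
      (M * P - M * Q) - (N * P - N * Q)     ≈⟨ +-cong (x[y-z]≈xy-xz M P Q) (-‿cong (x[y-z]≈xy-xz N P Q)) ⟨
      M * (P - Q) - N * (P - Q)             ≈⟨ [y-z]x≈yx-zx (P - Q) M N ⟨
      (M - N) * (P - Q)                     ∎
      where
      M N P Q : Carrier
      M = ι m
      N = ι n
      P = ι p
      Q = ι q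
      ι-+* : ∀ a b c d → ι (a ℕ.* b ℕ.+ c ℕ.* d) ≈ ι a * ι b + ι c * ι d
      ι-+* a b c d = trans (×-homo-+ 1# (a ℕ.* b) (c ℕ.* d)) (+-cong (×1-homo-* a b) (×1-homo-* c d))

    homomorphism : ℤ-rawRing ACR.-Raw-AlmostCommutative⟶ ACR.fromCommutativeRing R
    homomorphism = record
      { ⟦_⟧ = ⟦_⟧ᶜ
      ; +-homo = λ (m , n) (p , q) → via (normalise (m ℕ.+ p , n ℕ.+ q))
          (trans (normalise-correct (m ℕ.+ p) (n ℕ.+ q)) (+-homo m n p q))
          (+-cong (⟦⟧ᶜ≈⟦⟧ℤ (m , n)) (⟦⟧ᶜ≈⟦⟧ℤ (p , q)))
      ; *-homo = λ (m , n) (p , q) → via (normalise (m ℕ.* p ℕ.+ n ℕ.* q , m ℕ.* q ℕ.+ n ℕ.* p))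
          (trans (normalise-correct (m ℕ.* p ℕ.+ n ℕ.* q) (m ℕ.* q ℕ.+ n ℕ.* p)) (*-homo m n p q))
          (*-cong (⟦⟧ᶜ≈⟦⟧ℤ (m , n)) (⟦⟧ᶜ≈⟦⟧ℤ (p , q)))
      ; -‿homo = λ (m , n) → via (n , m)
          (sym (⁻¹-anti-homo‿- (ι m) (ι n)))
          (-‿cong (⟦⟧ᶜ≈⟦⟧ℤ (m , n)))
      ; 0-homo = refl
      ; 1-homo = refl
      }
      where
      via : ∀ x {y z} → ⟦ x ⟧ℤ ≈ y → z ≈ y → ⟦ x ⟧ᶜ ≈ z
      via x q r = trans (⟦⟧ᶜ≈⟦⟧ℤ x) (trans q (sym r))

    weaklyDecide : ∀ x y → Maybe (⟦ x ⟧ᶜ ≈ ⟦ y ⟧ᶜ)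
    weaklyDecide (m , n) (p , q) with m ℕ.+ q ℕ.≟ p ℕ.+ n
    ... | yes e = just (trans (⟦⟧ᶜ≈⟦⟧ℤ (m , n)) (trans (⟦⟧ℤ-cong m n p q e) (sym (⟦⟧ᶜ≈⟦⟧ℤ (p , q)))))
    ... | no _  = nothing

  open import Algebra.Solver.Ring ℤ-rawRing (ACR.fromCommutativeRing R) homomorphism weaklyDecide public

module FunctionalEquations {c ℓ : Level} (S : CommutativeRing c ℓ) where
  open CommutativeRing S
  open IntegerCoefficientSolver S
  open import Algebra.Properties.Ring ring using (x≈y⇒x∙y⁻¹≈ε)

  private
    one : ∀ {n} → Polynomial n
    one = con (1 , 0)

    -- Each lemma below is an ideal-membership statement: the conclusion
    -- minus its right-hand side is a combination of the hypotheses'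
    -- residues, with the coefficients checked by the ring solver.
    ≈-modulo : ∀ {x m e} → x ≈ m + e → e ≈ 0# → x ≈ m
    ≈-modulo {m = m} x≈m+e e≈0 = trans x≈m+e (trans (+-congˡ e≈0) (+-identityʳ m))

    residue : ∀ {x y} (k : Carrier) → x ≈ y → k * (x - y) ≈ 0#
    residue k x≈y = trans (*-congˡ (x≈y⇒x∙y⁻¹≈ε x≈y)) (zeroʳ k)

    _+₀_ : ∀ {e f} → e ≈ 0# → f ≈ 0# → e + f ≈ 0#
    e≈0 +₀ f≈0 = trans (+-cong e≈0 f≈0) (+-identityʳ 0#)

  jacobiTail-expansion : ∀ {γ δ X T T′} →
    T * ((1# - γ * X) - δ * ((X * X) * T′)) ≈ 1# →
    T ≈ 1# + X * ((γ + δ * (X * T′)) * T)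
  jacobiTail-expansion {γ} {δ} {X} {T} {T′} eq = ≈-modulo
    (solve 5 (λ γ δ X T T′ →
      T := (one :+ X :* ((γ :+ δ :* (X :* T′)) :* T))
           :+ one :* (T :* ((one :- γ :* X) :- δ :* ((X :* X) :* T′)) :- one))
      refl γ δ X T T′)
    (residue 1# eq)

  reversion-quadratic : ∀ {α r s X G A B C} →
    G * A ≈ 1# → A ≈ 1# + (X * G) * B → B ≈ - α + (X * G) * C → C ≈ r * B + s * A →
    G ≈ 1# + X * ((- r * G + (r + α) * (G * G)) + - s * (X * (G * G)))
  reversion-quadratic {α} {r} {s} {X} {G} {A} {B} {C} GA≈1 A≈ B≈ C≈ = ≈-modulo
    (solve 8 (λ α r s X G A B C →
      G := (one :+ X :* ((:- r :* G :+ (r :+ α) :* (G :* G)) :+ :- s :* (X :* (G :* G))))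
         :+ ((one :- r :* X :* G :- s :* X :* X :* (G :* G)) :* (G :* A :- one)
         :+ ((:- G :+ r :* X :* G :* G) :* (A :- (one :+ (X :* G) :* B))
         :+ ((:- (X :* (G :* G))) :* (B :- (:- α :+ (X :* G) :* C))
         :+ (:- (X :* X :* (G :* G) :* G)) :* (C :- (r :* B :+ s :* A))))))
      refl α r s X G A B C)
    (residue _ GA≈1 +₀ (residue _ A≈ +₀ (residue _ B≈ +₀ residue _ C≈)))

  jacobi-quadratic : ∀ {α β δ r s X T Q} →
    β ≈ r + (α + α) → δ ≈ α * (r + α) - s →
    T * ((1# - α * X) - δ * ((X * X) * Q)) ≈ 1# →
    Q * ((1# - β * X) - δ * ((X * X) * Q)) ≈ 1# →
    T ≈ 1# + X * ((- r * T + (r + α) * (T * T)) + - s * (X * (T * T)))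
  jacobi-quadratic {α} {β} {δ} {r} {s} {X} {T} {Q} β≈ δ≈ T-tail Q-tail = ≈-modulo
    (solve 8 (λ α β δ r s X T Q →
      let M = (one :- α :* X) :- δ :* ((X :* X) :* Q)
          V = (one :- α :* X) :* T :- one
      in
      T := (one :+ X :* ((:- r :* T :+ (r :+ α) :* (T :* T)) :+ :- s :* (X :* (T :* T))))
         :+ ((X :* (:- T :+ T :* T :- α :* X :* (T :* T))) :* (β :- (r :+ (α :+ α)))
         :+ ((X :* X :* (T :* T)) :* (δ :- (α :* (r :+ α) :- s))
         :+ ((δ :* (X :* X) :* (T :* T)) :* (Q :* ((one :- β :* X) :- δ :* ((X :* X) :* Q)) :- one)
         :+ (T :- β :* X :* T :- V :- V :+ (T :* M :- one)) :* (T :* M :- one)))))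
      refl α β δ r s X T Q)
    (residue _ β≈ +₀ (residue _ δ≈ +₀ (residue _ Q-tail +₀ residue _ T-tail)))

module PowerSeries {c ℓ : Level} (R : CommutativeRing c ℓ) where
  open CommutativeRing R
  open Series R
  open IntegerCoefficientSolver R using (solve; _:=_; _:+_; _:*_; _:-_; :-_; con)
  open import Relation.Binary.Reasoning.Setoid setoid

  -- Finite sums

  sumTo-cong : ∀ n {f g : ℕ → Carrier} → (∀ k → k < n → f k ≈ g k) → sumTo n f ≈ sumTo n g
  sumTo-cong zero    f≈g = refl
  sumTo-cong (suc n) f≈g = +-cong (sumTo-cong n (λ k k<n → f≈g k (ℕ.m<n⇒m<1+n k<n))) (f≈g n ℕ.≤-refl)

  sumTo-zero : ∀ n {f : ℕ → Carrier} → (∀ k → k < n → f k ≈ 0#) → sumTo n f ≈ 0#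
  sumTo-zero n f≈0 = trans (sumTo-cong n f≈0) (sumTo-const₀ n)
    where
    sumTo-const₀ : ∀ n → sumTo n (λ _ → 0#) ≈ 0#
    sumTo-const₀ zero    = refl
    sumTo-const₀ (suc n) = trans (+-identityʳ _) (sumTo-const₀ n)

  sumTo-distrib-+ : ∀ n (f g : ℕ → Carrier) →
    sumTo n (λ k → f k + g k) ≈ sumTo n f + sumTo n g
  sumTo-distrib-+ zero    f g = sym (+-identityˡ 0#)
  sumTo-distrib-+ (suc n) f g = begin
    sumTo n (λ k → f k + g k) + (f n + g n) ≈⟨ +-congʳ (sumTo-distrib-+ n f g) ⟩
    (sumTo n f + sumTo n g) + (f n + g n)   ≈⟨ interchange _ _ _ _ ⟩
    (sumTo n f + f n) + (sumTo n g + g n)   ∎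
    where open import Algebra.Properties.CommutativeSemigroup +-commutativeSemigroup using (interchange)

  *-distribˡ-sumTo : ∀ n x (f : ℕ → Carrier) → x * sumTo n f ≈ sumTo n (λ k → x * f k)
  *-distribˡ-sumTo zero    x f = zeroʳ x
  *-distribˡ-sumTo (suc n) x f = trans (distribˡ x (sumTo n f) (f n)) (+-congʳ (*-distribˡ-sumTo n x f))

  sumTo-unshift : ∀ n (f : ℕ → Carrier) → sumTo (suc n) f ≈ f 0 + sumTo n (λ k → f (suc k))
  sumTo-unshift zero    f = trans (+-identityˡ _) (sym (+-identityʳ _))
  sumTo-unshift (suc n) f = trans (+-congʳ (sumTo-unshift n f)) (+-assoc _ _ _)

  sumTo-comm : ∀ m n (h : ℕ → ℕ → Carrier) →
    sumTo m (λ i → sumTo n (h i)) ≈ sumTo n (λ j → sumTo m (λ i → h i j))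
  sumTo-comm zero    n h = sym (sumTo-zero n (λ _ _ → refl))
  sumTo-comm (suc m) n h = begin
    sumTo m (λ i → sumTo n (h i)) + sumTo n (h m)            ≈⟨ +-congʳ (sumTo-comm m n h) ⟩
    sumTo n (λ j → sumTo m (λ i → h i j)) + sumTo n (h m)    ≈⟨ sumTo-distrib-+ n _ _ ⟨
    sumTo n (λ j → sumTo m (λ i → h i j) + h m j)            ∎

  sumTo-extend : ∀ {m n} {f : ℕ → Carrier} → m ≤ n → (∀ k → m ≤ k → f k ≈ 0#) → sumTo m f ≈ sumTo n f
  sumTo-extend {m} {n} {f} m≤n f≈0 with ℕ.m≤n⇒∃[o]m+o≡n m≤n
  ... | d , ≡.refl = go d
    where
    go : ∀ d → sumTo m f ≈ sumTo (m ℕ.+ d) f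
    go zero    = reflexive (≡.cong (λ k → sumTo k f) (≡.sym (ℕ.+-identityʳ m)))
    go (suc d) = begin
      sumTo m f                          ≈⟨ go d ⟩
      sumTo (m ℕ.+ d) f                  ≈⟨ +-identityʳ _ ⟨
      sumTo (m ℕ.+ d) f + 0#             ≈⟨ +-congˡ (f≈0 (m ℕ.+ d) (ℕ.m≤m+n m d)) ⟨
      sumTo (m ℕ.+ d) f + f (m ℕ.+ d)    ≡⟨ ≡.cong (λ k → sumTo k f) (≡.sym (ℕ.+-suc m d)) ⟩
      sumTo (m ℕ.+ suc d) f              ∎

  sumTo-reverse : ∀ n (f : ℕ → Carrier) → sumTo (suc n) f ≈ sumTo (suc n) (λ k → f (n ∸ k))
  sumTo-reverse zero    f = refl
  sumTo-reverse (suc n) f = begin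
    sumTo (suc n) f + f (suc n)                          ≈⟨ +-congʳ (sumTo-reverse n f) ⟩
    sumTo (suc n) (λ k → f (n ∸ k)) + f (suc n)          ≈⟨ +-comm _ _ ⟩
    f (suc n) + sumTo (suc n) (λ k → f (n ∸ k))          ≈⟨ sumTo-unshift (suc n) (λ k → f (suc n ∸ k)) ⟨
    sumTo (suc (suc n)) (λ k → f (suc n ∸ k))            ∎

  -- Ordinary power series

  shift : Series → Series
  shift f n = f (suc n)

  ·-cong : ∀ {f f′ g g′} → f ≋ f′ → g ≋ g′ → (f · g) ≋ (f′ · g′)
  ·-cong f≈f′ g≈g′ n = sumTo-cong (suc n) (λ k _ → *-cong (f≈f′ k) (g≈g′ (n ∸ k)))

  ·-zeroth : ∀ f g → (f · g) 0 ≈ f 0 * g 0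
  ·-zeroth f g = +-identityˡ _

  shift-· : ∀ f g → shift (f · g) ≋ ((shift f · g) ⊕ scale (f 0) (shift g))
  shift-· f g n = trans (sumTo-unshift (suc n) _) (+-comm _ _)

  ·-comm : ∀ f g → (f · g) ≋ (g · f)
  ·-comm f g n = trans (sumTo-reverse n _) (sumTo-cong (suc n) swap)
    where
    swap : ∀ k → k < suc n → f (n ∸ k) * g (n ∸ (n ∸ k)) ≈ g k * f (n ∸ k)
    swap k (s≤s k≤n) = trans (*-comm _ _) (*-congʳ (reflexive (≡.cong g (ℕ.m∸[m∸n]≡n k≤n))))

  ·-distribʳ : ∀ f g h → ((f ⊕ g) · h) ≋ ((f · h) ⊕ (g · h))
  ·-distribʳ f g h n =
    trans (sumTo-cong (suc n) (λ k _ → distribʳ (h (n ∸ k)) (f k) (g k))) (sumTo-distrib-+ (suc n) _ _)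

  scale-· : ∀ x f g → (scale x f · g) ≋ scale x (f · g)
  scale-· x f g n =
    trans (sumTo-cong (suc n) (λ k _ → *-assoc x (f k) (g (n ∸ k)))) (sym (*-distribˡ-sumTo (suc n) x _))

  ·-zeroˡ : ∀ f g → (∀ k → f k ≈ 0#) → ∀ n → (f · g) n ≈ 0#
  ·-zeroˡ f g f≈0 n = sumTo-zero (suc n) (λ k _ → trans (*-congʳ (f≈0 k)) (zeroˡ _))

  ·-identityˡ : ∀ f → (oneS · f) ≋ f
  ·-identityˡ f zero    = trans (·-zeroth oneS f) (*-identityˡ _)
  ·-identityˡ f (suc n) = begin
    (oneS · f) (suc n)                    ≈⟨ shift-· oneS f n ⟩
    (shift oneS · f) n + 1# * f (suc n)   ≈⟨ +-cong (·-zeroˡ (shift oneS) f (λ _ → refl) n) (*-identityˡ _) ⟩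
    0# + f (suc n)                        ≈⟨ +-identityˡ _ ⟩
    f (suc n)                             ∎

  ·-assoc : ∀ f g h → ((f · g) · h) ≋ (f · (g · h))
  ·-assoc f g h zero = begin
    ((f · g) · h) 0      ≈⟨ trans (·-zeroth (f · g) h) (*-congʳ (·-zeroth f g)) ⟩
    (f 0 * g 0) * h 0    ≈⟨ *-assoc _ _ _ ⟩
    f 0 * (g 0 * h 0)    ≈⟨ trans (·-zeroth f (g · h)) (*-congˡ (·-zeroth g h)) ⟨
    (f · (g · h)) 0      ∎
  ·-assoc f g h (suc n) = begin
    ((f · g) · h) (suc n)
      ≈⟨ shift-· (f · g) h n ⟩
    (shift (f · g) · h) n + (f · g) 0 * h (suc n)
      ≈⟨ +-cong (·-cong {g = h} (shift-· f g) (λ _ → refl) n) (*-congʳ (·-zeroth f g)) ⟩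
    (((shift f · g) ⊕ scale (f 0) (shift g)) · h) n + (f 0 * g 0) * h (suc n)
      ≈⟨ +-congʳ (trans (·-distribʳ _ _ h n) (+-cong (·-assoc (shift f) g h n) (scale-· (f 0) (shift g) h n))) ⟩
    ((shift f · (g · h)) n + f 0 * (shift g · h) n) + (f 0 * g 0) * h (suc n)
      ≈⟨ solve 5 (λ a b c d e → (a :+ b :* c) :+ (b :* d) :* e := a :+ b :* (c :+ d :* e)) refl _ _ _ _ _ ⟩
    (shift f · (g · h)) n + f 0 * ((shift g · h) n + g 0 * h (suc n))
      ≈⟨ +-congˡ (*-congˡ (shift-· g h n)) ⟨
    (shift f · (g · h)) n + f 0 * (g · h) (suc n)
      ≈⟨ shift-· f (g · h) n ⟨
    (f · (g · h)) (suc n) ∎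

  negS : Series → Series
  negS f n = - f n

  powerSeriesRing : CommutativeRing c ℓ
  powerSeriesRing = record
    { Carrier = Series ; _≈_ = _≋_ ; _+_ = _⊕_ ; _*_ = _·_ ; -_ = negS ; 0# = λ _ → 0# ; 1# = oneS
    ; isCommutativeRing = record
      { isRing = record
        { +-isAbelianGroup = record
          { isGroup = record
            { isMonoid = record
              { isSemigroup = record
                { isMagma = record
                  { isEquivalence = record
                    { refl = λ _ → refl
                    ; sym = λ f≈g n → sym (f≈g n)
                    ; trans = λ f≈g g≈h n → trans (f≈g n) (g≈h n) }
                  ; ∙-cong = λ f≈f′ g≈g′ n → +-cong (f≈f′ n) (g≈g′ n) }
                ; assoc = λ f g h n → +-assoc (f n) (g n) (h n) }
              ; identity = (λ f n → +-identityˡ (f n)) , (λ f n → +-identityʳ (f n)) }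
            ; inverse = (λ f n → -‿inverseˡ (f n)) , (λ f n → -‿inverseʳ (f n))
            ; ⁻¹-cong = λ f≈g n → -‿cong (f≈g n) }
          ; comm = λ f g n → +-comm (f n) (g n) }
        ; *-cong = ·-cong
        ; *-assoc = ·-assoc
        ; *-identity = ·-identityˡ , (λ f n → trans (·-comm f oneS n) (·-identityˡ f n))
        ; distrib = (λ h f g n → trans (·-comm h (f ⊕ g) n)
                                   (trans (·-distribʳ f g h n) (+-cong (·-comm f h n) (·-comm g h n))))
                  , (λ h f g → ·-distribʳ f g h) }
      ; *-comm = ·-comm } }

  module S = CommutativeRing powerSeriesRing

  cst : Carrier → Series
  cst x = scale x oneS

  cst-cong : ∀ {x y} → x ≈ y → cst x ≋ cst y
  cst-cong x≈y n = *-congʳ x≈y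

  cst-1# : cst 1# ≋ oneS
  cst-1# n = *-identityˡ (oneS n)

  cst-+ : ∀ x y → cst (x + y) ≋ (cst x ⊕ cst y)
  cst-+ x y n = distribʳ (oneS n) x y

  cst-* : ∀ x y → cst (x * y) ≋ (cst x · cst y)
  cst-* x y n = sym (begin
    (cst x · cst y) n       ≈⟨ scale-· x oneS (cst y) n ⟩
    x * (oneS · cst y) n    ≈⟨ *-congˡ (·-identityˡ (cst y) n) ⟩
    x * (y * oneS n)        ≈⟨ *-assoc x y (oneS n) ⟨
    cst (x * y) n           ∎)

  cst-neg : ∀ x → cst (- x) ≋ negS (cst x)
  cst-neg x n = sym (-‿distribˡ-* x (oneS n))
    where open import Algebra.Properties.Ring ring using (-‿distribˡ-*)

  scale≋cst· : ∀ x f → scale x f ≋ (cst x · f)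
  scale≋cst· x f n = sym (trans (scale-· x oneS f n) (*-congˡ (·-identityˡ f n)))

  xS·-zeroth : ∀ f → (xS · f) 0 ≈ 0#
  xS·-zeroth f = trans (·-zeroth xS f) (zeroˡ _)

  xS·-suc : ∀ f n → (xS · f) (suc n) ≈ f n
  xS·-suc f n = begin
    (xS · f) (suc n)                  ≈⟨ shift-· xS f n ⟩
    (shift xS · f) n + 0# * f (suc n) ≈⟨ +-cong (·-cong {g = f} shift-xS (λ _ → refl) n) (zeroˡ _) ⟩
    (oneS · f) n + 0#                 ≈⟨ trans (+-identityʳ _) (·-identityˡ f n) ⟩
    f n                               ∎
    where
    shift-xS : shift xS ≋ oneS
    shift-xS zero    = refl
    shift-xS (suc _) = refl

  xS·-cancel : ∀ {f g} → (xS · f) ≋ (xS · g) → f ≋ g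
  xS·-cancel {f} {g} xf≈xg n = trans (sym (xS·-suc f n)) (trans (xf≈xg (suc n)) (xS·-suc g n))

  xS·-shift : ∀ {f} → f 0 ≈ 0# → f ≋ (xS · shift f)
  xS·-shift {f} f₀≈0 zero    = trans f₀≈0 (sym (xS·-zeroth (shift f)))
  xS·-shift {f} f₀≈0 (suc n) = sym (xS·-suc (shift f) n)

  unshift : ∀ f → f ≋ (cst (f 0) ⊕ (xS · shift f))
  unshift f zero    = sym (trans (+-cong (*-identityʳ _) (xS·-zeroth (shift f))) (+-identityʳ _))
  unshift f (suc n) = sym (trans (+-cong (zeroʳ _) (xS·-suc (shift f) n)) (+-identityˡ _))

  -- Composition

  compose-cong : ∀ {F F′} K → F ≋ F′ → compose F K ≋ compose F′ K
  compose-cong K F≈F′ n = sumTo-cong (suc n) (λ m _ → *-congʳ (F≈F′ m))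

  compose-⊕ : ∀ F H K → compose (F ⊕ H) K ≋ (compose F K ⊕ compose H K)
  compose-⊕ F H K n =
    trans (sumTo-cong (suc n) (λ m _ → distribʳ _ _ _)) (sumTo-distrib-+ (suc n) _ _)

  compose-scale : ∀ x F K → compose (scale x F) K ≋ scale x (compose F K)
  compose-scale x F K n =
    trans (sumTo-cong (suc n) (λ m _ → *-assoc _ _ _)) (sym (*-distribˡ-sumTo (suc n) x _))

  compose-oneS : ∀ K → compose oneS K ≋ oneS
  compose-oneS K n = begin
    compose oneS K n                                   ≈⟨ sumTo-unshift n _ ⟩
    1# * oneS n + sumTo n (λ m → 0# * powS K (suc m) n) ≈⟨ +-cong (*-identityˡ _) (sumTo-zero n (λ _ _ → zeroˡ _)) ⟩
    oneS n + 0#                                        ≈⟨ +-identityʳ _ ⟩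
    oneS n                                             ∎

  module _ {K : Series} (K₀≈0 : K 0 ≈ 0#) where

    powS-vanishes : ∀ m n → n < m → powS K m n ≈ 0#
    powS-vanishes (suc m) n (s≤s n≤m) = sumTo-zero (suc n) vanish
      where
      vanish : ∀ k → k < suc n → K k * powS K m (n ∸ k) ≈ 0#
      vanish zero    _         = trans (*-congʳ K₀≈0) (zeroˡ _)
      vanish (suc i) (s≤s i<n) = trans
        (*-congˡ (powS-vanishes m (n ∸ suc i) (ℕ.<-≤-trans (ℕ.∸-monoʳ-< (s≤s ℕ.z≤n) i<n) n≤m)))
        (zeroʳ _)

    compose-xS· : ∀ F → compose (xS · F) K ≋ (K · compose F K)
    compose-xS· F n = begin
      compose (xS · F) K n
        ≈⟨ sumTo-unshift n _ ⟩
      (xS · F) 0 * powS K 0 n + sumTo n (λ m → (xS · F) (suc m) * powS K (suc m) n)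
        ≈⟨ +-cong (trans (*-congʳ (xS·-zeroth F)) (zeroˡ _)) (sumTo-cong n (λ m _ → *-congʳ (xS·-suc F m))) ⟩
      0# + sumTo n (λ m → F m * sumTo (suc n) (λ j → K j * powS K m (n ∸ j)))
        ≈⟨ trans (+-identityˡ _) (sumTo-cong n (λ m _ → *-distribˡ-sumTo (suc n) (F m) _)) ⟩
      sumTo n (λ m → sumTo (suc n) (λ j → F m * (K j * powS K m (n ∸ j))))
        ≈⟨ sumTo-comm n (suc n) _ ⟩
      sumTo (suc n) (λ j → sumTo n (λ m → F m * (K j * powS K m (n ∸ j))))
        ≈⟨ sumTo-cong (suc n) (λ j _ → trans (sumTo-cong n (λ m _ → x∙yz≈y∙xz (F m) (K j) _))
                                              (sym (*-distribˡ-sumTo n (K j) _))) ⟩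
      sumTo (suc n) (λ j → K j * sumTo n (λ m → F m * powS K m (n ∸ j)))
        ≈⟨ sumTo-cong (suc n) truncate ⟩
      (K · compose F K) n ∎
      where
      open import Algebra.Properties.CommutativeSemigroup *-commutativeSemigroup using (x∙yz≈y∙xz)
      truncate : ∀ j → j < suc n →
        K j * sumTo n (λ m → F m * powS K m (n ∸ j)) ≈ K j * compose F K (n ∸ j)
      truncate zero    _         = trans (*-congʳ K₀≈0) (trans (zeroˡ _) (sym (trans (*-congʳ K₀≈0) (zeroˡ _))))
      truncate (suc i) (s≤s i<n) = *-congˡ (sym (sumTo-extend (ℕ.∸-monoʳ-< (s≤s ℕ.z≤n) i<n)
        (λ m n-i≤m → trans (*-congˡ (powS-vanishes m (n ∸ suc i) n-i≤m)) (zeroʳ _))))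

    compose-unshift : ∀ F → compose F K ≋ (cst (F 0) ⊕ (K · compose (shift F) K))
    compose-unshift F n = begin
      compose F K n
        ≈⟨ compose-cong K (unshift F) n ⟩
      compose (cst (F 0) ⊕ (xS · shift F)) K n
        ≈⟨ compose-⊕ _ _ K n ⟩
      compose (cst (F 0)) K n + compose (xS · shift F) K n
        ≈⟨ +-cong (trans (compose-scale (F 0) oneS K n) (*-congˡ (compose-oneS K n))) (compose-xS· (shift F) n) ⟩
      cst (F 0) n + (K · compose (shift F) K) n ∎

  -- Fixed points of causal equations

  Agree : ℕ → Series → Series → Set ℓ
  Agree n f g = ∀ m → m ≤ n → f m ≈ g m

  agree-refl : ∀ {n} f → Agree n f f
  agree-refl f m _ = refl

  agree-⊕ : ∀ {n f f′ g g′} → Agree n f f′ → Agree n g g′ → Agree n (f ⊕ g) (f′ ⊕ g′)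
  agree-⊕ f≈f′ g≈g′ m m≤n = +-cong (f≈f′ m m≤n) (g≈g′ m m≤n)

  agree-· : ∀ {n f f′ g g′} → Agree n f f′ → Agree n g g′ → Agree n (f · g) (f′ · g′)
  agree-· f≈f′ g≈g′ m m≤n = sumTo-cong (suc m) λ where
    k (s≤s k≤m) → *-cong (f≈f′ k (ℕ.≤-trans k≤m m≤n)) (g≈g′ (m ∸ k) (ℕ.≤-trans (ℕ.m∸n≤m m k) m≤n))

  Causal : ((ℕ → Series) → ℕ → Series) → Set (c ⊔ ℓ)
  Causal Φ = ∀ n V W → (∀ k → Agree n (V k) (W k)) → ∀ k → Agree n (Φ V k) (Φ W k)

  fixedPoint-unique : ∀ Φ → Causal Φ → ∀ {V W} →
    (∀ k → V k ≋ (oneS ⊕ (xS · Φ V k))) → (∀ k → W k ≋ (oneS ⊕ (xS · Φ W k))) →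
    ∀ k → V k ≋ W k
  fixedPoint-unique Φ causal {V} {W} V-fix W-fix k n = agree n k n ℕ.≤-refl
    where
    zeroth : ∀ {U} → (∀ k → U k ≋ (oneS ⊕ (xS · Φ U k))) → ∀ k → U k 0 ≈ 1#
    zeroth {U} U-fix k = trans (U-fix k 0) (trans (+-congˡ (xS·-zeroth (Φ U k))) (+-identityʳ 1#))

    successor : ∀ {U} → (∀ k → U k ≋ (oneS ⊕ (xS · Φ U k))) → ∀ k n → U k (suc n) ≈ Φ U k n
    successor {U} U-fix k n = trans (U-fix k (suc n)) (trans (+-congˡ (xS·-suc (Φ U k) n)) (+-identityˡ _))

    agree : ∀ n k → Agree n (V k) (W k)
    agree zero    k zero _ = trans (zeroth V-fix k) (sym (zeroth W-fix k))
    agree (suc n) k m m≤1+n with ℕ.m≤n⇒m<n∨m≡n m≤1+n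
    ... | inj₁ (s≤s m≤n) = agree n k m m≤n
    ... | inj₂ ≡.refl    = begin
      V k (suc n)  ≈⟨ successor V-fix k n ⟩
      Φ V k n      ≈⟨ causal n V W (agree n) k n ℕ.≤-refl ⟩
      Φ W k n      ≈⟨ successor W-fix k n ⟨
      W k (suc n)  ∎

  -- Exponential series

  fromℕ-+ : ∀ m n → fromℕ (m ℕ.+ n) ≈ fromℕ m + fromℕ n
  fromℕ-+ zero    n = sym (+-identityˡ _)
  fromℕ-+ (suc m) n = trans (+-congˡ (fromℕ-+ m n)) (sym (+-assoc _ _ _))

  ⊙-cong : ∀ {f f′ g g′} → f ≋ f′ → g ≋ g′ → (f ⊙ g) ≋ (f′ ⊙ g′)
  ⊙-cong f≈f′ g≈g′ n = sumTo-cong (suc n) (λ k _ → *-congˡ (*-cong (f≈f′ k) (g≈g′ (n ∸ k))))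

  ⊙-zeroth : ∀ f g → (f ⊙ g) 0 ≈ f 0 * g 0
  ⊙-zeroth f g = trans (+-identityˡ _) (trans (*-congʳ (+-identityʳ 1#)) (*-identityˡ _))

  -- Leibniz rule: on exponential series, shift is differentiation.
  shift-⊙ : ∀ f g → shift (f ⊙ g) ≋ ((shift f ⊙ g) ⊕ (f ⊙ shift g))
  shift-⊙ f g n = begin
    (f ⊙ g) (suc n)
      ≈⟨ sumTo-unshift (suc n) _ ⟩
    first + sumTo (suc n) (λ k → fromℕ (suc n C suc k) * fg k)
      ≈⟨ +-congˡ (sumTo-cong (suc n) (λ k _ → trans (*-congʳ (pascal k)) (distribʳ _ _ _))) ⟩
    first + sumTo (suc n) (λ k → fromℕ (n C k) * fg k + rest k)
      ≈⟨ +-congˡ (trans (sumTo-distrib-+ (suc n) _ _) (+-congˡ (trans (+-congˡ rest-last) (+-identityʳ _)))) ⟩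
    first + ((shift f ⊙ g) n + sumTo n rest)
      ≈⟨ x∙yz≈y∙xz _ _ _ ⟩
    (shift f ⊙ g) n + (first + sumTo n rest)
      ≈⟨ +-congˡ (+-congˡ (sumTo-cong n (λ k k<n → *-congˡ (*-congˡ (reindex k<n))))) ⟩
    (shift f ⊙ g) n + (first + sumTo n (λ k → fromℕ (n C suc k) * (f (suc k) * g (suc (n ∸ suc k)))))
      ≈⟨ +-congˡ (sumTo-unshift n _) ⟨
    (shift f ⊙ g) n + (f ⊙ shift g) n ∎
    where
    open import Algebra.Properties.CommutativeSemigroup +-commutativeSemigroup using (x∙yz≈y∙xz)
    first : Carrier
    first = fromℕ (n C 0) * (f 0 * g (suc n))
    fg : ℕ → Carrier
    fg k = f (suc k) * g (n ∸ k)
    rest : ℕ → Carrier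
    rest k = fromℕ (n C suc k) * fg k
    pascal : ∀ k → fromℕ (suc n C suc k) ≈ fromℕ (n C k) + fromℕ (n C suc k)
    pascal k = trans (reflexive (≡.cong fromℕ (≡.sym (nCk+nC[k+1]≡[n+1]C[k+1] n k))))
      (fromℕ-+ (n C k) (n C suc k))
    rest-last : rest n ≈ 0#
    rest-last = trans (*-congʳ (reflexive (≡.cong fromℕ (k>n⇒nCk≡0 (ℕ.n<1+n n))))) (zeroˡ _)
    reindex : ∀ {k} → k < n → g (n ∸ k) ≈ g (suc (n ∸ suc k))
    reindex k<n = reflexive (≡.cong g (ℕ.+-∸-assoc 1 k<n))

  ⊙-distribʳ : ∀ f g h → ((f ⊕ g) ⊙ h) ≋ ((f ⊙ h) ⊕ (g ⊙ h))
  ⊙-distribʳ f g h n = trans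
    (sumTo-cong (suc n) (λ k _ → trans (*-congˡ (distribʳ (h (n ∸ k)) (f k) (g k))) (distribˡ _ _ _)))
    (sumTo-distrib-+ (suc n) _ _)

  scale-⊙ : ∀ x f g → (scale x f ⊙ g) ≋ scale x (f ⊙ g)
  scale-⊙ x f g n = trans
    (sumTo-cong (suc n) (λ k _ → trans (*-congˡ (*-assoc x (f k) (g (n ∸ k)))) (x∙yz≈y∙xz _ x _)))
    (sym (*-distribˡ-sumTo (suc n) x _))
    where open import Algebra.Properties.CommutativeSemigroup *-commutativeSemigroup using (x∙yz≈y∙xz)

  ⊙-comm : ∀ f g → (f ⊙ g) ≋ (g ⊙ f)
  ⊙-comm f g zero    = trans (⊙-zeroth f g) (trans (*-comm _ _) (sym (⊙-zeroth g f)))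
  ⊙-comm f g (suc n) = begin
    (f ⊙ g) (suc n)                         ≈⟨ shift-⊙ f g n ⟩
    (shift f ⊙ g) n + (f ⊙ shift g) n       ≈⟨ +-cong (⊙-comm (shift f) g n) (⊙-comm f (shift g) n) ⟩
    (g ⊙ shift f) n + (shift g ⊙ f) n       ≈⟨ +-comm _ _ ⟩
    (shift g ⊙ f) n + (g ⊙ shift f) n       ≈⟨ shift-⊙ g f n ⟨
    (g ⊙ f) (suc n)                         ∎

  ⊙-distribˡ : ∀ f g h → (f ⊙ (g ⊕ h)) ≋ ((f ⊙ g) ⊕ (f ⊙ h))
  ⊙-distribˡ f g h n =
    trans (⊙-comm f (g ⊕ h) n) (trans (⊙-distribʳ g h f n) (+-cong (⊙-comm g f n) (⊙-comm h f n)))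

  ⊙-scale : ∀ x f g → (f ⊙ scale x g) ≋ scale x (f ⊙ g)
  ⊙-scale x f g n = trans (⊙-comm f (scale x g) n) (trans (scale-⊙ x g f n) (*-congˡ (⊙-comm g f n)))

  ⊙-assoc : ∀ f g h → ((f ⊙ g) ⊙ h) ≋ (f ⊙ (g ⊙ h))
  ⊙-assoc f g h zero = begin
    ((f ⊙ g) ⊙ h) 0      ≈⟨ trans (⊙-zeroth (f ⊙ g) h) (*-congʳ (⊙-zeroth f g)) ⟩
    (f 0 * g 0) * h 0    ≈⟨ *-assoc _ _ _ ⟩
    f 0 * (g 0 * h 0)    ≈⟨ trans (⊙-zeroth f (g ⊙ h)) (*-congˡ (⊙-zeroth g h)) ⟨
    (f ⊙ (g ⊙ h)) 0      ∎
  ⊙-assoc f g h (suc n) = begin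
    ((f ⊙ g) ⊙ h) (suc n)
      ≈⟨ shift-⊙ (f ⊙ g) h n ⟩
    (shift (f ⊙ g) ⊙ h) n + ((f ⊙ g) ⊙ shift h) n
      ≈⟨ +-congʳ (trans (⊙-cong {g = h} (shift-⊙ f g) (λ _ → refl) n) (⊙-distribʳ _ _ h n)) ⟩
    (((shift f ⊙ g) ⊙ h) n + ((f ⊙ shift g) ⊙ h) n) + ((f ⊙ g) ⊙ shift h) n
      ≈⟨ +-cong (+-cong (⊙-assoc (shift f) g h n) (⊙-assoc f (shift g) h n)) (⊙-assoc f g (shift h) n) ⟩
    ((shift f ⊙ (g ⊙ h)) n + (f ⊙ (shift g ⊙ h)) n) + (f ⊙ (g ⊙ shift h)) n
      ≈⟨ trans (+-assoc _ _ _) (+-congˡ (sym (⊙-distribˡ f (shift g ⊙ h) (g ⊙ shift h) n))) ⟩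
    (shift f ⊙ (g ⊙ h)) n + (f ⊙ ((shift g ⊙ h) ⊕ (g ⊙ shift h))) n
      ≈⟨ +-congˡ (⊙-cong {f = f} (λ _ → refl) (shift-⊙ g h) n) ⟨
    (shift f ⊙ (g ⊙ h)) n + (f ⊙ shift (g ⊙ h)) n
      ≈⟨ shift-⊙ f (g ⊙ h) n ⟨
    (f ⊙ (g ⊙ h)) (suc n) ∎

  ⊙-identityˡ : ∀ f → (oneS ⊙ f) ≋ f
  ⊙-identityˡ f n = begin
    (oneS ⊙ f) n
      ≈⟨ sumTo-unshift n _ ⟩
    (1# + 0#) * (1# * f n) + sumTo n (λ k → fromℕ (n C suc k) * (0# * f (n ∸ suc k)))
      ≈⟨ +-cong (trans (*-congʳ (+-identityʳ 1#)) (trans (*-identityˡ _) (*-identityˡ _)))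
                (sumTo-zero n (λ _ _ → trans (*-congˡ (zeroˡ _)) (zeroʳ _))) ⟩
    f n + 0#
      ≈⟨ +-identityʳ _ ⟩
    f n ∎

  ⊙-identityʳ : ∀ f → (f ⊙ oneS) ≋ f
  ⊙-identityʳ f n = trans (⊙-comm f oneS n) (⊙-identityˡ f n)

  ⊙-⊖ : ∀ f g h → (f ⊙ (g ⊖ h)) ≋ ((f ⊙ g) ⊖ (f ⊙ h))
  ⊙-⊖ f g h n = trans (⊙-distribˡ f g (negS h) n) (+-congˡ (begin
    (f ⊙ negS h) n            ≈⟨ ⊙-cong {f = f} (λ _ → refl) (λ k → sym (-1*x≈-x (h k))) n ⟩
    (f ⊙ scale (- 1#) h) n    ≈⟨ ⊙-scale (- 1#) f h n ⟩
    - 1# * (f ⊙ h) n          ≈⟨ -1*x≈-x _ ⟩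
    - (f ⊙ h) n               ∎))
    where open import Algebra.Properties.Ring ring using (-1*x≈-x)

  expS-⊙ : ∀ a b → (expS a ⊙ expS b) ≋ expS (a + b)
  expS-⊙ a b zero    = trans (⊙-zeroth (expS a) (expS b)) (*-identityˡ _)
  expS-⊙ a b (suc n) = begin
    (expS a ⊙ expS b) (suc n)
      ≈⟨ shift-⊙ (expS a) (expS b) n ⟩
    (scale a (expS a) ⊙ expS b) n + (expS a ⊙ scale b (expS b)) n
      ≈⟨ +-cong (scale-⊙ a (expS a) (expS b) n) (⊙-scale b (expS a) (expS b) n) ⟩
    a * (expS a ⊙ expS b) n + b * (expS a ⊙ expS b) n
      ≈⟨ distribʳ _ _ _ ⟨
    (a + b) * (expS a ⊙ expS b) n
      ≈⟨ *-congˡ (expS-⊙ a b n) ⟩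
    (a + b) * pow (a + b) n ∎

  ⊙-inverse-unique : ∀ {E F F′} → (E ⊙ F) ≋ oneS → (E ⊙ F′) ≋ oneS → F ≋ F′
  ⊙-inverse-unique {E} {F} {F′} EF≈1 EF′≈1 n = begin
    F n                   ≈⟨ ⊙-identityˡ F n ⟨
    (oneS ⊙ F) n          ≈⟨ ⊙-cong {g = F} (λ k → trans (sym (EF′≈1 k)) (⊙-comm E F′ k)) (λ _ → refl) n ⟩
    ((F′ ⊙ E) ⊙ F) n      ≈⟨ ⊙-assoc F′ E F n ⟩
    (F′ ⊙ (E ⊙ F)) n      ≈⟨ ⊙-cong {f = F′} (λ _ → refl) EF≈1 n ⟩
    (F′ ⊙ oneS) n         ≈⟨ ⊙-identityʳ F′ n ⟩
    F′ n                  ∎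

  expS-cong : ∀ {x y} → x ≈ y → expS x ≋ expS y
  expS-cong x≈y zero    = refl
  expS-cong x≈y (suc n) = *-cong x≈y (expS-cong x≈y n)

  expS-0# : expS 0# ≋ oneS
  expS-0# zero    = refl
  expS-0# (suc n) = zeroˡ _

  ⊙-inverse-of-quotient : ∀ {E F P u w p} → u * w ≈ 1# →
    (E ⊙ P) ≋ scale w (expS p) → (E ⊙ F) ≋ oneS → F ≋ scale u (expS (- p) ⊙ P)
  ⊙-inverse-of-quotient {E} {F} {P} {u} {w} {p} uw≈1 EP≈ EF≈1 = ⊙-inverse-unique EF≈1 λ n → begin
    (E ⊙ scale u (e ⊙ P)) n    ≈⟨ ⊙-scale u E (e ⊙ P) n ⟩
    u * (E ⊙ (e ⊙ P)) n        ≈⟨ *-congˡ reassociate ⟩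
    u * (e ⊙ (E ⊙ P)) n        ≈⟨ *-congˡ (trans (⊙-cong {f = e} (λ _ → refl) EP≈ n) (⊙-scale w e (expS p) n)) ⟩
    u * (w * (e ⊙ expS p) n)   ≈⟨ *-congˡ (*-congˡ (e⊙expS-p≋1 n)) ⟩
    u * (w * oneS n)           ≈⟨ trans (sym (*-assoc u w (oneS n))) (*-congʳ uw≈1) ⟩
    1# * oneS n                ≈⟨ *-identityˡ _ ⟩
    oneS n                     ∎
    where
    e : Series
    e = expS (- p)
    e⊙expS-p≋1 : (e ⊙ expS p) ≋ oneS
    e⊙expS-p≋1 n = trans (expS-⊙ (- p) p n) (trans (expS-cong (-‿inverseˡ p) n) (expS-0# n))
    reassociate : ∀ {n} → (E ⊙ (e ⊙ P)) n ≈ (e ⊙ (E ⊙ P)) n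
    reassociate {n} = trans (sym (⊙-assoc E e P n))
      (trans (⊙-cong {g = P} (⊙-comm E e) (λ _ → refl) n) (⊙-assoc e E P n))

  -- Reversion of recurrent series and Jacobi continued fractions

  quadraticPart : Carrier → Carrier → Carrier → Series → Series
  quadraticPart α r s W =
    ((negS (cst r) · W) ⊕ ((cst r ⊕ cst α) · (W · W))) ⊕ (negS (cst s) · (xS · (W · W)))

  quadratic-unique : ∀ {α r s V W} →
    V ≋ (oneS ⊕ (xS · quadraticPart α r s V)) → W ≋ (oneS ⊕ (xS · quadraticPart α r s W)) → V ≋ W
  quadratic-unique {α} {r} {s} V-fix W-fix =
    fixedPoint-unique (λ U k → quadraticPart α r s (U k)) causal (λ _ → V-fix) (λ _ → W-fix) 0
    where
    causal : Causal (λ U k → quadraticPart α r s (U k))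
    causal n U U′ U≈U′ k = agree-⊕
      (agree-⊕ (agree-· (agree-refl _) (U≈U′ k)) (agree-· (agree-refl _) (agree-· (U≈U′ k) (U≈U′ k))))
      (agree-· (agree-refl _) (agree-· (agree-refl xS) (agree-· (U≈U′ k) (U≈U′ k))))

  open FunctionalEquations powerSeriesRing using (jacobiTail-expansion; reversion-quadratic; jacobi-quadratic)

  jacobiTail : ∀ {cs ds T} → IsJacobiTails cs ds T → ∀ k {γ δ U} →
    cs k ≈ γ → ds (suc k) ≈ δ → T (suc k) ≋ U →
    (T k · ((oneS ⊖ (cst γ · xS)) ⊖ (cst δ · ((xS · xS) · U)))) ≋ oneS
  jacobiTail {cs} {ds} {T} tails k {γ} {δ} {U} cs≈γ ds≈δ T≈U = S.trans (S.*-congˡ {T k} multiplier) (tails k)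
    where
    multiplier : ((oneS ⊖ (cst γ · xS)) ⊖ (cst δ · ((xS · xS) · U)))
              ≋ ((oneS ⊖ scale (cs k) xS) ⊖ scale (ds (suc k)) ((xS · xS) · T (suc k)))
    multiplier n = +-cong
      (+-congˡ (-‿cong (trans (sym (scale≋cst· γ xS n)) (*-congʳ (sym cs≈γ)))))
      (-‿cong (begin
        (cst δ · ((xS · xS) · U)) n              ≈⟨ scale≋cst· δ ((xS · xS) · U) n ⟨
        δ * ((xS · xS) · U) n                    ≈⟨ *-cong ds≈δ (S.*-congˡ {xS · xS} T≈U n) ⟨
        ds (suc k) * ((xS · xS) · T (suc k)) n   ∎))

  jacobiTails-unique : ∀ {cs ds cs′ ds′ T T′} → IsJacobiTails cs ds T → IsJacobiTails cs′ ds′ T′ →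
    (∀ k → cs′ k ≈ cs k) → (∀ k → ds′ k ≈ ds k) → ∀ k → T k ≋ T′ k
  jacobiTails-unique {cs} {ds} {cs′} {ds′} {T} {T′} tails tails′ cs′≈cs ds′≈ds = fixedPoint-unique Φ causal
    (λ k → jacobiTail-expansion {T′ = T (suc k)} (jacobiTail {cs} {ds} {T} tails k refl refl S.refl))
    (λ k → jacobiTail-expansion {T′ = T′ (suc k)}
      (jacobiTail {cs′} {ds′} {T′} tails′ k (cs′≈cs k) (ds′≈ds (suc k)) S.refl))
    where
    Φ : (ℕ → Series) → ℕ → Series
    Φ U k = (cst (cs k) ⊕ (cst (ds (suc k)) · (xS · U (suc k)))) · U k
    causal : Causal Φ
    causal n U U′ U≈U′ k = agree-·
      (agree-⊕ (agree-refl _) (agree-· (agree-refl _) (agree-· (agree-refl xS) (U≈U′ (suc k)))))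
      (U≈U′ k)

  reversion-of-recurrent-quadratic : ∀ {α r s g K} →
    g 0 ≈ 1# → g 1 ≈ - α → (∀ n → g (suc (suc n)) ≈ r * g (suc n) + s * g n) →
    IsRev (xS · g) K → shift K ≋ (oneS ⊕ (xS · quadraticPart α r s (shift K)))
  reversion-of-recurrent-quadratic {α} {r} {s} {g} {K} g₀ g₁ g-rec (K₀≈0 , K-rev) =
    reversion-quadratic {A = A} {B} {C} GA≈1 A-unshift B-unshift C-rec
    where
    G A B C : Series
    G = shift K
    A = compose g K
    B = compose (shift g) K
    C = compose (shift (shift g)) K

    K≈xG : K ≋ (xS · G)
    K≈xG = xS·-shift K₀≈0

    GA≈1 : (G · A) ≋ oneS
    GA≈1 = xS·-cancel λ n → begin
      (xS · (G · A)) n         ≈⟨ ·-assoc xS G A n ⟨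
      ((xS · G) · A) n         ≈⟨ ·-cong {g = A} K≈xG (λ _ → refl) n ⟨
      (K · A) n                ≈⟨ compose-xS· K₀≈0 g n ⟨
      compose (xS · g) K n     ≈⟨ K-rev n ⟩
      xS n                     ≈⟨ S.*-identityʳ xS n ⟨
      (xS · oneS) n            ∎

    A-unshift : A ≋ (oneS ⊕ ((xS · G) · B))
    A-unshift = S.trans (compose-unshift K₀≈0 g)
      (S.+-cong (S.trans (cst-cong g₀) cst-1#) (S.*-congʳ {B} K≈xG))

    B-unshift : B ≋ (negS (cst α) ⊕ ((xS · G) · C))
    B-unshift = S.trans (compose-unshift K₀≈0 (shift g))
      (S.+-cong (S.trans (cst-cong g₁) (cst-neg α)) (S.*-congʳ {C} K≈xG))

    C-rec : C ≋ ((cst r · B) ⊕ (cst s · A))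
    C-rec n = begin
      C n                                                    ≈⟨ compose-cong K g-rec n ⟩
      compose (scale r (shift g) ⊕ scale s g) K n            ≈⟨ compose-⊕ _ _ K n ⟩
      compose (scale r (shift g)) K n + compose (scale s g) K n
        ≈⟨ +-cong (trans (compose-scale r _ K n) (scale≋cst· r B n)) (trans (compose-scale s g K n) (scale≋cst· s A n)) ⟩
      (cst r · B) n + (cst s · A) n                          ∎

  jacobi-constant-quadratic : ∀ {α r s cs ds T} → IsJacobiTails cs ds T →
    cs 0 ≈ α → (∀ k → cs (suc k) ≈ r + (α + α)) → (∀ k → ds (suc k) ≈ α * (r + α) - s) →
    T 0 ≋ (oneS ⊕ (xS · quadraticPart α r s (T 0)))
  jacobi-constant-quadratic {α} {r} {s} {cs} {ds} {T} tails cs₀≈ cs-suc≈ ds-suc≈ =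
    jacobi-quadratic β≈ δ≈
      (jacobiTail {cs} {ds} {T} tails 0 cs₀≈ (ds-suc≈ 0) (S.refl {T 1}))
      (jacobiTail {cs} {ds} {T} tails 1 (cs-suc≈ 0) (ds-suc≈ 1) (S.sym T₁≈T₂))
    where
    β≈ : cst (r + (α + α)) ≋ (cst r ⊕ (cst α ⊕ cst α))
    β≈ = S.trans (cst-+ r (α + α)) (S.+-congˡ (cst-+ α α))

    δ≈ : cst (α * (r + α) - s) ≋ ((cst α · (cst r ⊕ cst α)) ⊕ negS (cst s))
    δ≈ = S.trans (cst-+ (α * (r + α)) (- s))
      (S.+-cong (S.trans (cst-* α (r + α)) (S.*-congˡ (cst-+ r α))) (cst-neg s))

    T₁≈T₂ : T 1 ≋ T 2
    T₁≈T₂ = jacobiTails-unique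
      {λ k → cs (suc k)} {λ k → ds (suc k)} {λ k → cs (suc (suc k))} {λ k → ds (suc (suc k))}
      {λ k → T (suc k)} {λ k → T (suc (suc k))}
      (λ k → tails (suc k)) (λ k → tails (suc (suc k)))
      (λ k → trans (cs-suc≈ (suc k)) (sym (cs-suc≈ k)))
      (λ k → trans (ds-suc≈ (suc k)) (sym (ds-suc≈ k)))
      0

  reversion-of-recurrent-is-jacobi : ∀ {α r s g K cs ds T} →
    g 0 ≈ 1# → g 1 ≈ - α → (∀ n → g (suc (suc n)) ≈ r * g (suc n) + s * g n) →
    IsRev (xS · g) K →
    IsJacobiTails cs ds T →
    cs 0 ≈ α → (∀ k → cs (suc k) ≈ r + (α + α)) → (∀ k → ds (suc k) ≈ α * (r + α) - s) →
    shift K ≋ T 0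
  reversion-of-recurrent-is-jacobi {cs = cs} {ds} {T} g₀ g₁ g-rec rev tails cs₀≈ cs-suc≈ ds-suc≈ =
    quadratic-unique
      (reversion-of-recurrent-quadratic g₀ g₁ g-rec rev)
      (jacobi-constant-quadratic {cs = cs} {ds} {T} tails cs₀≈ cs-suc≈ ds-suc≈)

  -- The series E

  module InverseOfE (a b y u : Carrier) (u-inverse : u * (1# - y) ≈ 1#) (E : Series)
    (E-quotient : (E ⊙ (oneS ⊖ scale y (expS (b * (1# - y))))) ≋ scale (1# - y) (expS (a * (1# - y))))
    (Einv : Series) (Einv-inverse : (E ⊙ Einv) ≋ oneS) where

    w p q α r s : Carrier
    w = 1# - y
    p = a * w
    q = - p + b * w
    α = y * (b - a) + a
    r = - p + q
    s = - (- p * q)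

    Einv-closedForm : Einv ≋ scale u (expS (- p) ⊖ scale y (expS q))
    Einv-closedForm = S.trans (⊙-inverse-of-quotient {P = P} u-inverse E-quotient Einv-inverse)
      λ n → *-congˡ (begin
        (expS (- p) ⊙ P) n
          ≈⟨ ⊙-⊖ (expS (- p)) oneS (scale y (expS (b * w))) n ⟩
        (expS (- p) ⊙ oneS) n - (expS (- p) ⊙ scale y (expS (b * w))) n
          ≈⟨ +-cong (⊙-identityʳ _ n) (-‿cong (⊙-scale y (expS (- p)) (expS (b * w)) n)) ⟩
        expS (- p) n - y * (expS (- p) ⊙ expS (b * w)) n
          ≈⟨ +-congˡ (-‿cong (*-congˡ (expS-⊙ (- p) (b * w) n))) ⟩
        expS (- p) n - y * expS q n ∎)
      where
      P : Series
      P = oneS ⊖ scale y (expS (b * w))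

    Einv-zeroth : Einv 0 ≈ 1#
    Einv-zeroth = trans (Einv-closedForm 0) (trans (*-congˡ (+-congˡ (-‿cong (*-identityʳ y)))) u-inverse)

    Einv-first : Einv 1 ≈ - α
    Einv-first = begin
      Einv 1                             ≈⟨ Einv-closedForm 1 ⟩
      u * ((- p) * 1# - y * (q * 1#))    ≈⟨ *-congˡ (solve 3 (λ a b y →
        let w = con (1 , 0) :- y ; p = a :* w in
        (:- p) :* con (1 , 0) :- y :* ((:- p :+ b :* w) :* con (1 , 0)) := w :* (:- (y :* (b :- a) :+ a)))
        refl a b y) ⟩
      u * (w * - α)                      ≈⟨ *-assoc u w (- α) ⟨
      (u * w) * - α                      ≈⟨ trans (*-congʳ u-inverse) (*-identityˡ _) ⟩
      - α                                ∎

    Einv-recurrence : ∀ n → Einv (suc (suc n)) ≈ r * Einv (suc n) + s * Einv n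
    Einv-recurrence n = begin
      Einv (suc (suc n))
        ≈⟨ Einv-closedForm (suc (suc n)) ⟩
      u * ((- p) * ((- p) * A) - y * (q * (q * B)))
        ≈⟨ solve 6 (λ u y p q A B →
             u :* ((:- p) :* ((:- p) :* A) :- y :* (q :* (q :* B)))
             := (:- p :+ q) :* (u :* ((:- p) :* A :- y :* (q :* B))) :+ (:- (:- p :* q)) :* (u :* (A :- y :* B)))
           refl u y p q A B ⟩
      r * (u * ((- p) * A - y * (q * B))) + s * (u * (A - y * B))
        ≈⟨ +-cong (*-congˡ (Einv-closedForm (suc n))) (*-congˡ (Einv-closedForm n)) ⟨
      r * Einv (suc n) + s * Einv n ∎
      where
      A B : Carrier
      A = pow (- p) n
      B = pow q n

    cSeq-suc≈ : b * (y + 1#) ≈ r + (α + α)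
    cSeq-suc≈ = solve 3 (λ a b y →
      let w = con (1 , 0) :- y ; p = a :* w ; α = y :* (b :- a) :+ a in
      b :* (y :+ con (1 , 0)) := (:- p :+ (:- p :+ b :* w)) :+ (α :+ α)) refl a b y

    dSeq≈ : (b * b) * y ≈ α * (r + α) - s
    dSeq≈ = solve 3 (λ a b y →
      let w = con (1 , 0) :- y ; p = a :* w ; q = :- p :+ b :* w ; α = y :* (b :- a) :+ a in
      (b :* b) :* y := α :* ((:- p :+ q) :+ α) :- (:- (:- p :* q))) refl a b y

mainTheorem1 : {c ℓ : Level} (R : CommutativeRing c ℓ) →
  let open CommutativeRing R
      open Series R
  in (a b y : Carrier) →
     -- y ≠ 1 in the strong algebraic sense: 1 - y is invertible
     (∃ λ u → u * (1# - y) ≈ 1#) →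
     -- E(t) = (1-y) e^{a t (1-y)} / (1 - y e^{b t (1-y)}) as an exponential series
     (E : Series) →
     (E ⊙ (oneS ⊖ scale y (expS (b * (1# - y))))) ≋ scale (1# - y) (expS (a * (1# - y))) →
     -- Einv = 1/E
     (Einv : Series) → (E ⊙ Einv) ≋ oneS →
     -- K = Rev(x g(x)) with g = S(1/E)
     (K : Series) → IsRev (xS · sumudu Einv) K →
     -- T = tails of J(y(b-a)+a, b(y+1), b(y+1), ... ; b²y, b²y, ...)
     (T : ℕ → Series) →
     IsJacobiTails
       (cSeq a b y)
       (λ _ → (b * b) * y)
       T →
     -- G(x) = K(x)/x equals the continued fraction
     (λ n → K (suc n)) ≋ T 0
mainTheorem1 R a b y (u , u-inverse) E E-quotient Einv Einv-inverse K rev T tails =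
  reversion-of-recurrent-is-jacobi {cs = cSeq a b y} {λ _ → (b * b) * y} {T}
    Einv-zeroth Einv-first Einv-recurrence rev tails refl (λ _ → cSeq-suc≈) (λ _ → dSeq≈)
  where
  open CommutativeRing R using (_*_; refl)
  open Series R using (cSeq)
  open PowerSeries R using (reversion-of-recurrent-is-jacobi)
  open PowerSeries.InverseOfE R a b y u u-inverse E E-quotient Einv Einv-inverse
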